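{- For every $d\ge 3$, $$\dim(Q_d)-1\le \mathrm{edim}(Q_d)\le \dim(Q_d)=\mathrm{mdim}(Q_d).$$
   Context: The hypercube $Q_d$ has vertex set $\{0,1\}^d$, two vertices adjacent iff they differ in exactly one coordinate; distance is the number of differing coordinates. For a vertex $x$ and an edge $uv$, $d(uv,x)=\min\{d(u,x),d(v,x)\}$. A set $S$ of vertices is a metric generator (resp. edge metric generator, mixed metric generator) if every two distinct vertices (resp. every two distinct edges, every two distinct elements of $V\cup E$) $a,b$ have some $s\in S$ with $d(a,s)\ne d(b,s)$. $\dim$, $\mathrm{edim}$, $\mathrm{mdim}$ denote the minimum cardinalities of a metric generator, an edge metric generator and a mixed metric generator, respectively. -}

module Defs where

open import Data.Bool using (Bool; true; false; _xor_)
open import Data.Nat using (ℕ; zero; suc; _+_; _≤_; _⊓_)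
open import Data.Vec using (Vec; []; _∷_)
open import Data.List using (List; length)
open import Data.List.Relation.Unary.Any using (Any)
open import Data.Product using (Σ; _×_; _,_; ∃)
open import Data.Sum using (_⊎_; inj₁; inj₂)
open import Data.Unit using (⊤)
open import Relation.Nullary using (¬_)
open import Relation.Binary.PropositionalEquality using (_≡_; _≢_)

Vertex : ℕ → Set
Vertex d = Vec Bool d

-- Hamming distance (= graph distance in Q_d): number of differing coordinates.
dist : ∀ {d} → Vertex d → Vertex d → ℕ
dist [] [] = zero
dist (a ∷ u) (b ∷ v) with a xor b
... | true  = suc (dist u v)
... | false = dist u v

Adj : ∀ {d} → Vertex d → Vertex d → Set
Adj u v = dist u v ≡ 1

record Edge (d : ℕ) : Set where
  constructor edge
  field
    end₁ : Vertex d
    end₂ : Vertex d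
    adj  : Adj end₁ end₂
open Edge public

SameEdge : ∀ {d} → Edge d → Edge d → Set
SameEdge e f = (end₁ e ≡ end₁ f × end₂ e ≡ end₂ f) ⊎ (end₁ e ≡ end₂ f × end₂ e ≡ end₁ f)

edist : ∀ {d} → Edge d → Vertex d → ℕ
edist e x = dist (end₁ e) x ⊓ dist (end₂ e) x

Elem : ℕ → Set
Elem d = Vertex d ⊎ Edge d

DistinctElem : ∀ {d} → Elem d → Elem d → Set
DistinctElem (inj₁ u) (inj₁ v) = u ≢ v
DistinctElem (inj₂ e) (inj₂ f) = ¬ SameEdge e f
DistinctElem (inj₁ _) (inj₂ _) = ⊤
DistinctElem (inj₂ _) (inj₁ _) = ⊤

mdist : ∀ {d} → Elem d → Vertex d → ℕ
mdist (inj₁ u) x = dist u x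
mdist (inj₂ e) x = edist e x

-- A set S of vertices is represented by a list; its cardinality by its length
-- (duplicates can only increase the length, so minima are unaffected).
MetricGenerator : ∀ {d} → List (Vertex d) → Set
MetricGenerator {d} S =
  (a b : Vertex d) → a ≢ b → Any (λ s → dist a s ≢ dist b s) S

EdgeMetricGenerator : ∀ {d} → List (Vertex d) → Set
EdgeMetricGenerator {d} S =
  (a b : Edge d) → ¬ SameEdge a b → Any (λ s → edist a s ≢ edist b s) S

MixedMetricGenerator : ∀ {d} → List (Vertex d) → Set
MixedMetricGenerator {d} S =
  (a b : Elem d) → DistinctElem a b → Any (λ s → mdist a s ≢ mdist b s) S

IsMinCard : ∀ {d} → (List (Vertex d) → Set) → ℕ → Set
IsMinCard {d} P k =
  (Σ (List (Vertex d)) λ S → P S × length S ≡ k) ×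
  ((S : List (Vertex d)) → P S → k ≤ length S)

IsDim IsEdim IsMdim : ℕ → ℕ → Set
IsDim  d k = IsMinCard {d} MetricGenerator k
IsEdim d k = IsMinCard {d} EdgeMetricGenerator k
IsMdim d k = IsMinCard {d} MixedMetricGenerator k

-- Complementing a landmark s keeps every pair resolved, as d(x, s̄) = d − d(x, s).  A metric
-- generator of Q_d, d ≥ 3, has at least three landmarks, and complementing a suitable subset of
-- the first two makes no coordinate constant over it: a coordinate constant for all four
-- choices would yield four coordinates carrying two vertices at equal distance from every
-- landmark.  Such a generator is mixed.  The distance from s to an edge along direction i has the
-- parity of a constant plus s_i + |s|, so a vertex and an edge are resolved once column i is not
-- constant, and edges along i ≠ j once s_i + s_j is not constant (which a metric generator
-- guarantees); parallel edges are told apart by their endpoints with coordinate i cleared.  Hence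
-- mdim = dim ≥ edim.  Conversely, the pairs left unresolved by an edge metric generator are
-- antipodal, and there is at most one such pair {a, ā}; adding a gives a metric generator, so
-- dim ≤ edim + 1.

module Submission where

open import Defs
open import Data.Bool using (Bool; true; false; not; _xor_; _∧_; _∨_; if_then_else_)
open import Data.Bool.Properties
  using ( xor-assoc; xor-comm; xor-same; xor-identityʳ; xor-inverseˡ; not-involutive; not-¬; ¬-not
        ; xor-∧-commutativeRing )
  renaming (_≟_ to _≟ᵇ_)
open import Data.Nat using (ℕ; zero; suc; _+_; _≤_; _<_; _⊓_; _≟_; s≤s)
open import Data.Nat.Properties
  using ( +-comm; +-assoc; +-identityʳ; +-cancelˡ-≡; +-cancelʳ-≡; +-distribˡ-⊓; +-suc; suc-injective
        ; +-commutativeSemigroup; 0≢1+n; ≮⇒≥; ≤-trans; ≤-reflexive; anyUpTo?)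
open import Data.Nat.Induction using (<-rec)
open import Data.Fin using (Fin; zero; suc)
open import Data.Fin.Properties using (any?) renaming (_≟_ to _≟ᶠ_)
open import Data.Vec using (Vec; []; _∷_; lookup; _[_]≔_; map; zipWith; replicate)
open import Data.Vec.Properties
  using ( ≡-dec; ∷-injectiveˡ; ∷-injectiveʳ; tabulate∘lookup; tabulate-cong; lookup-map
        ; lookup∘update; lookup∘update′; []≔-idempotent; []≔-commutes; []≔-lookup )
open import Data.Vec.Relation.Unary.All as VecAll using ([]; _∷_)
open import Data.Vec.Relation.Unary.Unique.Propositional using (Unique; []; _∷_)
open import Data.List using (List; []; _∷_; length; _++_)
import Data.List as List
open import Data.List.Membership.Propositional using (_∈_; lose)
open import Data.List.Membership.Propositional.Properties using (∈-map⁺; ∈-++⁺ˡ; ∈-++⁺ʳ)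
open import Data.List.Relation.Unary.All as All using (All; []; _∷_; all?)
open import Data.List.Relation.Unary.All.Properties using (¬All⇒Any¬; Any¬⇒¬All)
open import Data.List.Relation.Unary.Any as Any using (Any; here; there; satisfied)
open import Data.Product using (Σ; _×_; _,_; ∃)
open import Data.Sum using (_⊎_; inj₁; inj₂; [_,_]′)
open import Data.Empty using (⊥; ⊥-elim)
open import Function using (_∘_)
open import Relation.Nullary using (¬_; Dec; yes; no; contradiction)
open import Relation.Nullary.Decidable as Dec using (_⊎-dec_; _×-dec_; _→-dec_; ¬?)
open import Relation.Unary using (Decidable)
open import Relation.Binary using (DecidableEquality)
open import Relation.Binary.PropositionalEquality
open import Algebra using (CommutativeRing)
import Algebra.Properties.CommutativeSemigroup as CommutativeSemigroupProperties

private
  variable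
    d k : ℕ

module Xor =
  CommutativeSemigroupProperties (CommutativeRing.+-commutativeSemigroup xor-∧-commutativeRing)
module Nat = CommutativeSemigroupProperties +-commutativeSemigroup

xor-involutiveʳ : ∀ a b → (a xor b) xor b ≡ a
xor-involutiveʳ a b = trans (xor-assoc a b b) (trans (cong (a xor_) (xor-same b)) (xor-identityʳ a))

xor-cancelʳ : ∀ a b c → a xor c ≡ b xor c → a ≡ b
xor-cancelʳ a b c eq = trans (sym (xor-involutiveʳ a c)) (trans (cong (_xor c) eq) (xor-involutiveʳ b c))

xor-solveʳ : ∀ a b c → a xor b ≡ c → b ≡ a xor c
xor-solveʳ a b c eq =
  trans (sym (xor-involutiveʳ b a)) (trans (cong (_xor a) (trans (xor-comm b a) eq)) (xor-comm c a))

xor-transpose : ∀ a b c e → a xor b ≡ c xor e → b xor e ≡ a xor c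
xor-transpose a b c e eq = trans (cong (_xor e) (xor-solveʳ a b (c xor e) eq))
  (trans (xor-assoc a (c xor e) e) (cong (a xor_) (xor-involutiveʳ c e)))

bitDist : Bool → Bool → ℕ
bitDist a b = if a xor b then 1 else 0

bitDist-self : ∀ a → bitDist a a ≡ 0
bitDist-self a = cong (if_then 1 else 0) (xor-same a)

dist-∷ : ∀ a b (u v : Vertex d) → dist (a ∷ u) (b ∷ v) ≡ bitDist a b + dist u v
dist-∷ true  true  u v = refl
dist-∷ true  false u v = refl
dist-∷ false true  u v = refl
dist-∷ false false u v = refl

dist-self : (u : Vertex d) → dist u u ≡ 0
dist-self []      = refl
dist-self (a ∷ u) = trans (dist-∷ a a u u) (cong₂ _+_ (bitDist-self a) (dist-self u))

dist-sym : (u v : Vertex d) → dist u v ≡ dist v u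
dist-sym []      []      = refl
dist-sym (a ∷ u) (b ∷ v) = begin
  dist (a ∷ u) (b ∷ v)    ≡⟨ dist-∷ a b u v ⟩
  bitDist a b + dist u v  ≡⟨ cong₂ _+_ (cong (if_then 1 else 0) (xor-comm a b)) (dist-sym u v) ⟩
  bitDist b a + dist v u  ≡⟨ sym (dist-∷ b a v u) ⟩
  dist (b ∷ v) (a ∷ u)    ∎
  where open ≡-Reasoning

dist≡0⇒≡ : (u v : Vertex d) → dist u v ≡ 0 → u ≡ v
dist≡0⇒≡ []          []          _  = refl
dist≡0⇒≡ (true ∷ u)  (true ∷ v)  eq = cong (true ∷_) (dist≡0⇒≡ u v eq)
dist≡0⇒≡ (false ∷ u) (false ∷ v) eq = cong (false ∷_) (dist≡0⇒≡ u v eq)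

dist-[]≔ : (u s : Vertex d) (i : Fin d) (b : Bool) →
           dist (u [ i ]≔ b) s ≡ dist (u [ i ]≔ lookup s i) s + bitDist b (lookup s i)
dist-[]≔ (a ∷ u) (c ∷ s) zero b = begin
  dist (b ∷ u) (c ∷ s)                  ≡⟨ dist-∷ b c u s ⟩
  bitDist b c + dist u s                ≡⟨ +-comm (bitDist b c) (dist u s) ⟩
  dist u s + bitDist b c                ≡⟨ cong (λ n → n + dist u s + bitDist b c) (sym (bitDist-self c)) ⟩
  bitDist c c + dist u s + bitDist b c  ≡⟨ cong (_+ bitDist b c) (sym (dist-∷ c c u s)) ⟩
  dist (c ∷ u) (c ∷ s) + bitDist b c    ∎
  where open ≡-Reasoning
dist-[]≔ (a ∷ u) (c ∷ s) (suc i) b = begin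
  dist (a ∷ u [ i ]≔ b) (c ∷ s)                          ≡⟨ dist-∷ a c _ s ⟩
  bitDist a c + dist (u [ i ]≔ b) s                      ≡⟨ cong (bitDist a c +_) (dist-[]≔ u s i b) ⟩
  bitDist a c + (dist (u [ i ]≔ lookup s i) s + bitDist b (lookup s i))
    ≡⟨ sym (+-assoc (bitDist a c) _ _) ⟩
  bitDist a c + dist (u [ i ]≔ lookup s i) s + bitDist b (lookup s i)
    ≡⟨ cong (_+ bitDist b (lookup s i)) (sym (dist-∷ a c _ s)) ⟩
  dist (a ∷ u [ i ]≔ lookup s i) (c ∷ s) + bitDist b (lookup s i)  ∎
  where open ≡-Reasoning

dist-split : (u s : Vertex d) (i : Fin d) →
             dist u s ≡ dist (u [ i ]≔ lookup s i) s + bitDist (lookup u i) (lookup s i)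
dist-split u s i = trans (cong (λ v → dist v s) (sym ([]≔-lookup u i))) (dist-[]≔ u s i (lookup u i))

_≟ᵛ_ : DecidableEquality (Vertex d)
_≟ᵛ_ = ≡-dec _≟ᵇ_

infixl 8 _⟪_≔_⟫
infix 7 _↾_

_⟪_≔_⟫ : Vertex d → Vec (Fin d) k → Vec Bool k → Vertex d
z ⟪ []     ≔ []     ⟫ = z
z ⟪ i ∷ is ≔ b ∷ bs ⟫ = (z [ i ]≔ b) ⟪ is ≔ bs ⟫

_↾_ : Vertex d → Vec (Fin d) k → Vec Bool k
s ↾ is = map (lookup s) is

lookup-⟪⟫ : (z : Vertex d) {i : Fin d} {is : Vec (Fin d) k} (bs : Vec Bool k) →
            VecAll.All (i ≢_) is → lookup (z ⟪ is ≔ bs ⟫) i ≡ lookup z i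
lookup-⟪⟫ z []       []            = refl
lookup-⟪⟫ z (b ∷ bs) (i≢j ∷ i∉is) = trans (lookup-⟪⟫ (z [ _ ]≔ b) bs i∉is) (lookup∘update′ i≢j z b)

[]≔-⟪⟫ : (z : Vertex d) {i : Fin d} {is : Vec (Fin d) k} (a : Bool) (bs : Vec Bool k) →
         VecAll.All (i ≢_) is → (z ⟪ is ≔ bs ⟫) [ i ]≔ a ≡ (z [ i ]≔ a) ⟪ is ≔ bs ⟫
[]≔-⟪⟫ z a []       []            = refl
[]≔-⟪⟫ z {i} {j ∷ is} a (b ∷ bs) (i≢j ∷ i∉is) =
  trans ([]≔-⟪⟫ (z [ j ]≔ b) a bs i∉is) (cong (_⟪ is ≔ bs ⟫) ([]≔-commutes z j i (i≢j ∘ sym)))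

⟪⟫-↾ : (z : Vertex d) {is : Vec (Fin d) k} (bs : Vec Bool k) → Unique is → (z ⟪ is ≔ bs ⟫) ↾ is ≡ bs
⟪⟫-↾ z []       []             = refl
⟪⟫-↾ z {i ∷ is} (b ∷ bs) (i∉is ∷ u) =
  cong₂ _∷_ (trans (lookup-⟪⟫ (z [ i ]≔ b) bs i∉is) (lookup∘update i z b)) (⟪⟫-↾ (z [ i ]≔ b) bs u)

dist-⟪⟫ : (z s : Vertex d) {is : Vec (Fin d) k} (bs : Vec Bool k) → Unique is →
          dist (z ⟪ is ≔ bs ⟫) s ≡ dist (z ⟪ is ≔ s ↾ is ⟫) s + dist bs (s ↾ is)
dist-⟪⟫ z s []       [] = sym (+-identityʳ (dist z s))
dist-⟪⟫ z s {i ∷ is} (b ∷ bs) (i∉is ∷ u) = begin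
  dist ((z [ i ]≔ b) ⟪ is ≔ bs ⟫) s
    ≡⟨ dist-⟪⟫ (z [ i ]≔ b) s bs u ⟩
  dist ((z [ i ]≔ b) ⟪ is ≔ s ↾ is ⟫) s + dist bs (s ↾ is)
    ≡⟨ cong (λ v → dist v s + dist bs (s ↾ is)) (sym ([]≔-⟪⟫ z b (s ↾ is) i∉is)) ⟩
  dist (Y [ i ]≔ b) s + dist bs (s ↾ is)
    ≡⟨ cong (_+ dist bs (s ↾ is)) (dist-[]≔ Y s i b) ⟩
  dist (Y [ i ]≔ sᵢ) s + bitDist b sᵢ + dist bs (s ↾ is)
    ≡⟨ cong (λ v → dist v s + bitDist b sᵢ + dist bs (s ↾ is)) ([]≔-⟪⟫ z sᵢ (s ↾ is) i∉is) ⟩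
  dist ((z [ i ]≔ sᵢ) ⟪ is ≔ s ↾ is ⟫) s + bitDist b sᵢ + dist bs (s ↾ is)
    ≡⟨ +-assoc _ (bitDist b sᵢ) (dist bs (s ↾ is)) ⟩
  dist ((z [ i ]≔ sᵢ) ⟪ is ≔ s ↾ is ⟫) s + (bitDist b sᵢ + dist bs (s ↾ is))
    ≡⟨ cong (dist ((z [ i ]≔ sᵢ) ⟪ is ≔ s ↾ is ⟫) s +_) (sym (dist-∷ b sᵢ bs (s ↾ is))) ⟩
  dist ((z [ i ]≔ sᵢ) ⟪ is ≔ s ↾ is ⟫) s + dist (b ∷ bs) (sᵢ ∷ s ↾ is)  ∎
  where
  open ≡-Reasoning
  sᵢ = lookup s i
  Y = z ⟪ is ≔ s ↾ is ⟫

dist-⟪⟫-cong : (z s : Vertex d) {is : Vec (Fin d) k} {bs cs : Vec Bool k} → Unique is →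
               dist bs (s ↾ is) ≡ dist cs (s ↾ is) → dist (z ⟪ is ≔ bs ⟫) s ≡ dist (z ⟪ is ≔ cs ⟫) s
dist-⟪⟫-cong z s {bs = bs} {cs} u eq =
  trans (dist-⟪⟫ z s bs u) (trans (cong (_ +_) eq) (sym (dist-⟪⟫ z s cs u)))

Unresolved : List (Vertex d) → (Vertex d → ℕ) → (Vertex d → ℕ) → Set
Unresolved S f g = All (λ s → f s ≡ g s) S

separated : {f g : Vertex d → ℕ} (S : List (Vertex d)) → ¬ Unresolved S f g → Any (λ s → f s ≢ g s) S
separated S = ¬All⇒Any¬ (λ s → _ ≟ _) S

unresolved⇒≡ : {S : List (Vertex d)} {x y : Vertex d} →
               MetricGenerator S → Unresolved S (dist x) (dist y) → x ≡ y
unresolved⇒≡ {x = x} {y} gen unresolved with x ≟ᵛ y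
... | yes x≡y = x≡y
... | no  x≢y = contradiction unresolved (Any¬⇒¬All (gen x y x≢y))

equidistant-assignments⇒¬MetricGenerator :
  {S : List (Vertex d)} {is : Vec (Fin d) k} {bs cs : Vec Bool k} →
  Unique is → bs ≢ cs → All (λ s → dist bs (s ↾ is) ≡ dist cs (s ↾ is)) S → ¬ MetricGenerator S
equidistant-assignments⇒¬MetricGenerator {d} {is = is} {bs} {cs} u bs≢cs equidistant gen = bs≢cs (begin
  bs                  ≡⟨ sym (⟪⟫-↾ z bs u) ⟩
  z ⟪ is ≔ bs ⟫ ↾ is  ≡⟨ cong (_↾ is) (unresolved⇒≡ {x = z ⟪ is ≔ bs ⟫} {z ⟪ is ≔ cs ⟫} gen unresolved) ⟩
  z ⟪ is ≔ cs ⟫ ↾ is  ≡⟨ ⟪⟫-↾ z cs u ⟩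
  cs                  ∎)
  where
  open ≡-Reasoning
  z = replicate d false
  unresolved : Unresolved _ (dist (z ⟪ is ≔ bs ⟫)) (dist (z ⟪ is ≔ cs ⟫))
  unresolved = All.map (λ {s} → dist-⟪⟫-cong z s {bs = bs} {cs} u) equidistant

xor-column-nonconstant : {S : List (Vertex d)} {i j : Fin d} (c : Bool) →
  MetricGenerator S → i ≢ j → ¬ All (λ s → lookup s i xor lookup s j ≡ c) S
xor-column-nonconstant {i = i} {j} c gen i≢j columns =
  equidistant-assignments⇒¬MetricGenerator {bs = true ∷ c ∷ []} {false ∷ not c ∷ []}
    ((i≢j ∷ []) ∷ [] ∷ []) (λ ()) (All.map (λ {s} → equidistant s) columns) gen
  where
  one-of-two : ∀ a b →
    dist (true ∷ (a xor b) ∷ []) (a ∷ b ∷ []) ≡ dist (false ∷ not (a xor b) ∷ []) (a ∷ b ∷ [])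
  one-of-two true  true  = refl
  one-of-two true  false = refl
  one-of-two false true  = refl
  one-of-two false false = refl
  equidistant : (s : Vertex _) → lookup s i xor lookup s j ≡ c →
    dist (true ∷ c ∷ []) (s ↾ (i ∷ j ∷ [])) ≡ dist (false ∷ not c ∷ []) (s ↾ (i ∷ j ∷ []))
  equidistant s refl = one-of-two (lookup s i) (lookup s j)

pair-¬MetricGenerator : (s₁ s₂ : Vertex (3 + d)) → ¬ MetricGenerator (s₁ ∷ s₂ ∷ [])
pair-¬MetricGenerator s₁ s₂ gen =
  [ coinciding-columns {zero} {suc zero} (λ ())
  , [ coinciding-columns {zero} {suc (suc zero)} (λ ())
    , coinciding-columns {suc zero} {suc (suc zero)} (λ ()) ]′ ]′
  (bit-pigeonhole (t zero) (t (suc zero)) (t (suc (suc zero))))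
  where
  t : Fin _ → Bool
  t i = lookup s₁ i xor lookup s₂ i
  bit-pigeonhole : ∀ a b c → a ≡ b ⊎ a ≡ c ⊎ b ≡ c
  bit-pigeonhole true  true  _     = inj₁ refl
  bit-pigeonhole false false _     = inj₁ refl
  bit-pigeonhole true  false true  = inj₂ (inj₁ refl)
  bit-pigeonhole true  false false = inj₂ (inj₂ refl)
  bit-pigeonhole false true  true  = inj₂ (inj₂ refl)
  bit-pigeonhole false true  false = inj₂ (inj₁ refl)
  coinciding-columns : {i j : Fin _} → i ≢ j → t i ≡ t j → ⊥
  coinciding-columns {i} {j} i≢j tᵢ≡tⱼ =
    xor-column-nonconstant (lookup s₁ i xor lookup s₁ j) gen i≢j
      (refl ∷ xor-transpose (lookup s₁ i) (lookup s₂ i) (lookup s₁ j) (lookup s₂ j) tᵢ≡tⱼ ∷ [])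

parity : Vertex d → Bool
parity []      = false
parity (a ∷ u) = a xor parity u

odd : ℕ → Bool
odd zero    = false
odd (suc n) = not (odd n)

odd-bitDist+ : ∀ a b n → odd (bitDist a b + n) ≡ (a xor b) xor odd n
odd-bitDist+ a b n = odd-if (a xor b)
  where
  odd-if : ∀ t → odd ((if t then 1 else 0) + n) ≡ t xor odd n
  odd-if true  = refl
  odd-if false = refl

odd-dist : (u s : Vertex d) → odd (dist u s) ≡ parity u xor parity s
odd-dist []      []      = refl
odd-dist (a ∷ u) (c ∷ s) = begin
  odd (dist (a ∷ u) (c ∷ s))                ≡⟨ cong odd (dist-∷ a c u s) ⟩
  odd (bitDist a c + dist u s)              ≡⟨ odd-bitDist+ a c (dist u s) ⟩
  (a xor c) xor odd (dist u s)              ≡⟨ cong ((a xor c) xor_) (odd-dist u s) ⟩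
  (a xor c) xor (parity u xor parity s)     ≡⟨ Xor.interchange a c (parity u) (parity s) ⟩
  (a xor parity u) xor (c xor parity s)     ∎
  where open ≡-Reasoning

parity-[]≔ : (u : Vertex d) (i : Fin d) (b : Bool) → parity (u [ i ]≔ b) ≡ parity (u [ i ]≔ false) xor b
parity-[]≔ (a ∷ u) zero    b = xor-comm b (parity u)
parity-[]≔ (a ∷ u) (suc i) b = trans (cong (a xor_) (parity-[]≔ u i b)) (sym (xor-assoc a _ b))

flipAt : Vertex d → Fin d → Vertex d
flipAt u i = u [ i ]≔ not (lookup u i)

flipAt-involutive : (u : Vertex d) (i : Fin d) → flipAt (flipAt u i) i ≡ u
flipAt-involutive u i = begin
  flipAt u i [ i ]≔ not (lookup (flipAt u i) i)  ≡⟨ cong (λ b → flipAt u i [ i ]≔ not b) (lookup∘update i u _) ⟩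
  flipAt u i [ i ]≔ not (not (lookup u i))       ≡⟨ []≔-idempotent u i ⟩
  u [ i ]≔ not (not (lookup u i))                ≡⟨ cong (u [ i ]≔_) (not-involutive (lookup u i)) ⟩
  u [ i ]≔ lookup u i                            ≡⟨ []≔-lookup u i ⟩
  u                                              ∎
  where open ≡-Reasoning

flipAt-adjacent : (u : Vertex d) (i : Fin d) → Adj u (flipAt u i)
flipAt-adjacent u i = begin
  dist u (flipAt u i)                                   ≡⟨ dist-sym u (flipAt u i) ⟩
  dist (flipAt u i) u                                   ≡⟨ dist-[]≔ u u i (not (lookup u i)) ⟩
  dist (u [ i ]≔ lookup u i) u + bitDist (not (lookup u i)) (lookup u i)
    ≡⟨ cong₂ _+_ (trans (cong (λ v → dist v u) ([]≔-lookup u i)) (dist-self u))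
                 (cong (if_then 1 else 0) (xor-inverseˡ (lookup u i))) ⟩
  1                                                     ∎
  where open ≡-Reasoning

adjacent⇒flipAt : (u v : Vertex d) → Adj u v → Σ (Fin d) λ i → v ≡ flipAt u i
adjacent⇒flipAt []          []          ()
adjacent⇒flipAt (true ∷ u)  (true ∷ v)  adj with adjacent⇒flipAt u v adj
... | i , v≡ = suc i , cong (true ∷_) v≡
adjacent⇒flipAt (false ∷ u) (false ∷ v) adj with adjacent⇒flipAt u v adj
... | i , v≡ = suc i , cong (false ∷_) v≡
adjacent⇒flipAt (true ∷ u)  (false ∷ v) adj = zero , cong (false ∷_) (sym (dist≡0⇒≡ u v (suc-injective adj)))
adjacent⇒flipAt (false ∷ u) (true ∷ v)  adj = zero , cong (true ∷_)  (sym (dist≡0⇒≡ u v (suc-injective adj)))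

edgeAt : Vertex d → Fin d → Edge d
edgeAt u i = edge u (flipAt u i) (flipAt-adjacent u i)

Along : Edge d → Fin d → Set
Along e i = end₂ e ≡ flipAt (end₁ e) i

direction : (e : Edge d) → Σ (Fin d) (Along e)
direction e = adjacent⇒flipAt (end₁ e) (end₂ e) (adj e)

edist-flipAt : (u s : Vertex d) (i : Fin d) →
               dist u s ⊓ dist (flipAt u i) s ≡ dist (u [ i ]≔ lookup s i) s
edist-flipAt u s i = begin
  dist u s ⊓ dist (flipAt u i) s
    ≡⟨ cong₂ _⊓_ (dist-split u s i) (dist-[]≔ u s i (not (lookup u i))) ⟩
  (D + bitDist (lookup u i) (lookup s i)) ⊓ (D + bitDist (not (lookup u i)) (lookup s i))
    ≡⟨ sym (+-distribˡ-⊓ D _ _) ⟩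
  D + (bitDist (lookup u i) (lookup s i) ⊓ bitDist (not (lookup u i)) (lookup s i))
    ≡⟨ cong (D +_) (one-matches (lookup u i) (lookup s i)) ⟩
  D + 0
    ≡⟨ +-identityʳ D ⟩
  D ∎
  where
  open ≡-Reasoning
  D = dist (u [ i ]≔ lookup s i) s
  one-matches : ∀ a c → bitDist a c ⊓ bitDist (not a) c ≡ 0
  one-matches true  true  = refl
  one-matches true  false = refl
  one-matches false true  = refl
  one-matches false false = refl

edist-along : (e : Edge d) {i : Fin d} → Along e i → (s : Vertex d) →
              edist e s ≡ dist (end₁ e [ i ]≔ lookup s i) s
edist-along (edge u _ _) {i} refl s = edist-flipAt u s i

edgeParity : Edge d → Fin d → Bool
edgeParity e i = parity (end₁ e [ i ]≔ false)

odd-edist : (e : Edge d) {i : Fin d} → Along e i → (s : Vertex d) →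
            odd (edist e s) ≡ (edgeParity e i xor lookup s i) xor parity s
odd-edist e {i} along s = begin
  odd (edist e s)                                ≡⟨ cong odd (edist-along e along s) ⟩
  odd (dist (end₁ e [ i ]≔ lookup s i) s)        ≡⟨ odd-dist (end₁ e [ i ]≔ lookup s i) s ⟩
  parity (end₁ e [ i ]≔ lookup s i) xor parity s ≡⟨ cong (_xor parity s) (parity-[]≔ (end₁ e) i (lookup s i)) ⟩
  (edgeParity e i xor lookup s i) xor parity s   ∎
  where open ≡-Reasoning

ConstantColumn : List (Vertex d) → Fin d → Set
ConstantColumn S i = Σ Bool λ c → All (λ s → lookup s i ≡ c) S

vertex-edge-unresolved⇒ConstantColumn : {S : List (Vertex d)} {x : Vertex d} {e : Edge d} {i : Fin d} →
  Along e i → Unresolved S (dist x) (edist e) → ConstantColumn S i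
vertex-edge-unresolved⇒ConstantColumn {x = x} {e} {i} along unresolved =
  edgeParity e i xor parity x , All.map (λ {s} → column s) unresolved
  where
  column : ∀ s → dist x s ≡ edist e s → lookup s i ≡ edgeParity e i xor parity x
  column s eq = xor-solveʳ (edgeParity e i) (lookup s i) (parity x) (sym (xor-cancelʳ _ _ (parity s)
    (trans (sym (odd-dist x s)) (trans (cong odd eq) (odd-edist e along s)))))

edges-unresolved⇒xor-column : {S : List (Vertex d)} {e f : Edge d} {i j : Fin d} →
  Along e i → Along f j → Unresolved S (edist e) (edist f) →
  All (λ s → lookup s i xor lookup s j ≡ edgeParity e i xor edgeParity f j) S
edges-unresolved⇒xor-column {e = e} {f} {i} {j} alongᵉ alongᶠ = All.map (λ {s} → column s)
  where
  column : ∀ s → edist e s ≡ edist f s → lookup s i xor lookup s j ≡ edgeParity e i xor edgeParity f j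
  column s eq = xor-transpose (edgeParity e i) (lookup s i) (edgeParity f j) (lookup s j)
    (xor-cancelʳ _ _ (parity s) (trans (sym (odd-edist e alongᵉ s)) (trans (cong odd eq) (odd-edist f alongᶠ s))))

[]≔-≡⇒≡[]≔ : (u w : Vertex d) (i : Fin d) {b : Bool} →
             u [ i ]≔ b ≡ w [ i ]≔ b → w ≡ u [ i ]≔ lookup w i
[]≔-≡⇒≡[]≔ u w i {b} eq = begin
  w                            ≡⟨ sym ([]≔-lookup w i) ⟩
  w [ i ]≔ lookup w i          ≡⟨ sym ([]≔-idempotent w i) ⟩
  w [ i ]≔ b [ i ]≔ lookup w i ≡⟨ cong (_[ i ]≔ lookup w i) (sym eq) ⟩
  u [ i ]≔ b [ i ]≔ lookup w i ≡⟨ []≔-idempotent u i ⟩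
  u [ i ]≔ lookup w i          ∎
  where open ≡-Reasoning

[]≔-≡⇒≡⊎flipAt : (u w : Vertex d) (i : Fin d) {b : Bool} →
                 u [ i ]≔ b ≡ w [ i ]≔ b → w ≡ u ⊎ w ≡ flipAt u i
[]≔-≡⇒≡⊎flipAt u w i eq with lookup w i ≟ᵇ lookup u i
... | yes wᵢ≡uᵢ = inj₁ (trans ([]≔-≡⇒≡[]≔ u w i eq) (trans (cong (u [ i ]≔_) wᵢ≡uᵢ) ([]≔-lookup u i)))
... | no  wᵢ≢uᵢ = inj₂ (trans ([]≔-≡⇒≡[]≔ u w i eq) (cong (u [ i ]≔_) (¬-not wᵢ≢uᵢ)))

along-SameEdge : {e f : Edge d} {i : Fin d} → Along e i → Along f i →
                 end₁ f ≡ end₁ e ⊎ end₁ f ≡ flipAt (end₁ e) i → SameEdge e f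
along-SameEdge {i = i} alongᵉ alongᶠ (inj₁ w≡u) =
  inj₁ (sym w≡u , trans alongᵉ (trans (cong (λ v → flipAt v i) (sym w≡u)) (sym alongᶠ)))
along-SameEdge {e = e} {i = i} alongᵉ alongᶠ (inj₂ w≡ū) =
  inj₂ ( sym (trans alongᶠ (trans (cong (λ v → flipAt v i) w≡ū) (flipAt-involutive (end₁ e) i)))
       , trans alongᵉ (sym w≡ū) )

parallel-edges-unresolved⇒SameEdge : {S : List (Vertex d)} {e f : Edge d} {i : Fin d} →
  MetricGenerator S → Along e i → Along f i → Unresolved S (edist e) (edist f) → SameEdge e f
parallel-edges-unresolved⇒SameEdge {e = e} {f} {i} gen alongᵉ alongᶠ unresolved =
  along-SameEdge {e = e} {f} alongᵉ alongᶠ ([]≔-≡⇒≡⊎flipAt u w i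
    (unresolved⇒≡ {x = u [ i ]≔ false} {w [ i ]≔ false} gen (All.map (λ {s} → projection s) unresolved)))
  where
  u = end₁ e
  w = end₁ f
  projection : ∀ s → edist e s ≡ edist f s → dist (u [ i ]≔ false) s ≡ dist (w [ i ]≔ false) s
  projection s eq = begin
    dist (u [ i ]≔ false) s                           ≡⟨ dist-[]≔ u s i false ⟩
    dist (u [ i ]≔ lookup s i) s + bitDist false (lookup s i)
      ≡⟨ cong (_+ bitDist false (lookup s i)) (trans (sym (edist-along e alongᵉ s)) (trans eq (edist-along f alongᶠ s))) ⟩
    dist (w [ i ]≔ lookup s i) s + bitDist false (lookup s i)
      ≡⟨ sym (dist-[]≔ w s i false) ⟩
    dist (w [ i ]≔ false) s                           ∎
    where open ≡-Reasoning

edges-unresolved⇒SameEdge : {S : List (Vertex d)} → MetricGenerator S →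
  (e f : Edge d) → Unresolved S (edist e) (edist f) → SameEdge e f
edges-unresolved⇒SameEdge gen e f unresolved with direction e | direction f
... | i , alongᵉ | j , alongᶠ with i ≟ᶠ j
... | yes refl = parallel-edges-unresolved⇒SameEdge {e = e} {f} gen alongᵉ alongᶠ unresolved
... | no  i≢j  =
  ⊥-elim (xor-column-nonconstant _ gen i≢j (edges-unresolved⇒xor-column {e = e} {f} alongᵉ alongᶠ unresolved))

vertex-edge-resolved : {S : List (Vertex d)} → (∀ i → ¬ ConstantColumn S i) →
  (x : Vertex d) (e : Edge d) → ¬ Unresolved S (dist x) (edist e)
vertex-edge-resolved nc x e unresolved with direction e
... | i , along = nc i (vertex-edge-unresolved⇒ConstantColumn {x = x} {e} along unresolved)

mixedMetricGenerator : {S : List (Vertex d)} →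
  MetricGenerator S → (∀ i → ¬ ConstantColumn S i) → MixedMetricGenerator S
mixedMetricGenerator gen nc (inj₁ x) (inj₁ y) x≢y = gen x y x≢y
mixedMetricGenerator gen nc (inj₁ x) (inj₂ e) _   = separated _ (vertex-edge-resolved nc x e)
mixedMetricGenerator gen nc (inj₂ e) (inj₁ x) _   = separated _ (vertex-edge-resolved nc x e ∘ All.map sym)
mixedMetricGenerator gen nc (inj₂ e) (inj₂ f) e≉f = separated _ (e≉f ∘ edges-unresolved⇒SameEdge gen e f)

complement : Vertex d → Vertex d
complement = map not

complementIf : Bool → Vertex d → Vertex d
complementIf false s = s
complementIf true  s = complement s

lookup-complementIf : (b : Bool) (s : Vertex d) (i : Fin d) →
                      lookup (complementIf b s) i ≡ b xor lookup s i
lookup-complementIf false s i = refl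
lookup-complementIf true  s i = lookup-map i not s

dist-complement : (u s : Vertex d) → dist u (complement s) + dist u s ≡ d
dist-complement []      []      = refl
dist-complement (a ∷ u) (c ∷ s) = begin
  dist (a ∷ u) (not c ∷ complement s) + dist (a ∷ u) (c ∷ s)
    ≡⟨ cong₂ _+_ (dist-∷ a (not c) u (complement s)) (dist-∷ a c u s) ⟩
  (bitDist a (not c) + dist u (complement s)) + (bitDist a c + dist u s)
    ≡⟨ Nat.interchange (bitDist a (not c)) (dist u (complement s)) (bitDist a c) (dist u s) ⟩
  (bitDist a (not c) + bitDist a c) + (dist u (complement s) + dist u s)
    ≡⟨ cong₂ _+_ (exactly-one a c) (dist-complement u s) ⟩
  suc _ ∎
  where
  open ≡-Reasoning
  exactly-one : ∀ a c → bitDist a (not c) + bitDist a c ≡ 1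
  exactly-one true  true  = refl
  exactly-one true  false = refl
  exactly-one false true  = refl
  exactly-one false false = refl

complementIf-unresolved : (b : Bool) (x y s : Vertex d) →
  dist x (complementIf b s) ≡ dist y (complementIf b s) → dist x s ≡ dist y s
complementIf-unresolved false x y s eq = eq
complementIf-unresolved true  x y s eq = +-cancelˡ-≡ (dist x (complement s)) (dist x s) (dist y s)
  (trans (dist-complement x s) (sym (trans (cong (_+ dist y s) eq) (dist-complement y s))))

complementIf-MetricGenerator : (b₁ b₂ : Bool) {s₁ s₂ : Vertex d} {R : List (Vertex d)} →
  MetricGenerator (s₁ ∷ s₂ ∷ R) → MetricGenerator (complementIf b₁ s₁ ∷ complementIf b₂ s₂ ∷ R)
complementIf-MetricGenerator b₁ b₂ {s₁} {s₂} gen x y x≢y = separated _ λ where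
  (h₁ ∷ h₂ ∷ hs) → x≢y (unresolved⇒≡ gen
    (complementIf-unresolved b₁ x y s₁ h₁ ∷ complementIf-unresolved b₂ x y s₂ h₂ ∷ hs))

_⊕_ : Vec Bool k → Vec Bool k → Vec Bool k
_⊕_ = zipWith _xor_

dist-⊕ : (m m′ r : Vec Bool k) → dist (m ⊕ r) (m′ ⊕ r) ≡ dist m m′
dist-⊕ []      []       []      = refl
dist-⊕ (a ∷ m) (b ∷ m′) (c ∷ r) = begin
  dist ((a xor c) ∷ m ⊕ r) ((b xor c) ∷ m′ ⊕ r)       ≡⟨ dist-∷ (a xor c) (b xor c) (m ⊕ r) (m′ ⊕ r) ⟩
  bitDist (a xor c) (b xor c) + dist (m ⊕ r) (m′ ⊕ r)
    ≡⟨ cong₂ _+_ (cong (if_then 1 else 0) xor-translate) (dist-⊕ m m′ r) ⟩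
  bitDist a b + dist m m′                              ≡⟨ sym (dist-∷ a b m m′) ⟩
  dist (a ∷ m) (b ∷ m′)                                ∎
  where
  open ≡-Reasoning
  xor-translate : (a xor c) xor (b xor c) ≡ a xor b
  xor-translate =
    trans (Xor.interchange a c b c) (trans (cong ((a xor b) xor_) (xor-same c)) (xor-identityʳ _))

record Pattern (s₁ s₂ s₃ : Vertex d) (rest : List (Vertex d)) (i : Fin d) (b₁ b₂ : Bool) : Set where
  field
    at₁    : lookup s₁ i ≡ b₁ xor lookup s₃ i
    at₂    : lookup s₂ i ≡ b₂ xor lookup s₃ i
    atRest : All (λ s → lookup s i ≡ lookup s₃ i) rest
open Pattern

ConstantColumn⇒Pattern : {s₁ s₂ s₃ : Vertex d} {rest : List (Vertex d)} {i : Fin d} (b₁ b₂ : Bool) →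
  ConstantColumn (complementIf b₁ s₁ ∷ complementIf b₂ s₂ ∷ s₃ ∷ rest) i → Pattern s₁ s₂ s₃ rest i b₁ b₂
ConstantColumn⇒Pattern {s₁ = s₁} {s₂} {s₃} {i = i} b₁ b₂ (c , h₁ ∷ h₂ ∷ h₃ ∷ hs) = record
  { at₁    = xor-solveʳ b₁ (lookup s₁ i) (lookup s₃ i) (relative b₁ s₁ h₁)
  ; at₂    = xor-solveʳ b₂ (lookup s₂ i) (lookup s₃ i) (relative b₂ s₂ h₂)
  ; atRest = All.map (λ h → trans h (sym h₃)) hs
  }
  where
  relative : ∀ b s → lookup (complementIf b s) i ≡ c → b xor lookup s i ≡ lookup s₃ i
  relative b s h = trans (sym (lookup-complementIf b s i)) (trans h (sym h₃))

Pattern-distinct : {s₁ s₂ s₃ : Vertex d} {rest : List (Vertex d)} {i j : Fin d} {b₁ b₂ c₁ c₂ : Bool} →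
  Pattern s₁ s₂ s₃ rest i b₁ b₂ → Pattern s₁ s₂ s₃ rest j c₁ c₂ → ¬ (b₁ ≡ c₁ × b₂ ≡ c₂) → i ≢ j
Pattern-distinct {s₃ = s₃} {i = i} {b₁ = b₁} {b₂} {c₁} {c₂} pᵢ pⱼ different refl = different
  ( xor-cancelʳ b₁ c₁ (lookup s₃ i) (trans (sym (at₁ pᵢ)) (at₁ pⱼ))
  , xor-cancelʳ b₂ c₂ (lookup s₃ i) (trans (sym (at₂ pᵢ)) (at₂ pⱼ)) )

-- On the four coordinates every landmark reads 0000, 0011 or 0101 relative to s₃, and each of these
-- is at distance 2 from both 0110 and 1001.
four-patterns⇒¬MetricGenerator : {s₁ s₂ s₃ : Vertex d} {rest : List (Vertex d)} {p q u w : Fin d} →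
  Pattern s₁ s₂ s₃ rest p false false → Pattern s₁ s₂ s₃ rest q false true →
  Pattern s₁ s₂ s₃ rest u true  false → Pattern s₁ s₂ s₃ rest w true  true  →
  ¬ MetricGenerator (s₁ ∷ s₂ ∷ s₃ ∷ rest)
four-patterns⇒¬MetricGenerator {s₁ = s₁} {s₂} {s₃} {rest} {p} {q} {u} {w} P₀₀ P₀₁ P₁₀ P₁₁ =
  equidistant-assignments⇒¬MetricGenerator {bs = m₁ ⊕ r} {m₂ ⊕ r} unique
    (λ eq → not-¬ refl (∷-injectiveˡ eq))
    ( equidistant s₁ (false ∷ false ∷ true  ∷ true  ∷ []) refl (vec₄ (at₁ P₀₀) (at₁ P₀₁) (at₁ P₁₀) (at₁ P₁₁))
    ∷ equidistant s₂ (false ∷ true  ∷ false ∷ true  ∷ []) refl (vec₄ (at₂ P₀₀) (at₂ P₀₁) (at₂ P₁₀) (at₂ P₁₁))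
    ∷ equidistant s₃ zeros refl refl
    ∷ All.map (λ {s} (e₁ , e₂ , e₃ , e₄) → equidistant s zeros refl (vec₄ e₁ e₂ e₃ e₄))
        (All.zip (atRest P₀₀ , All.zip (atRest P₀₁ , All.zip (atRest P₁₀ , atRest P₁₁)))))
  where
  is = p ∷ q ∷ u ∷ w ∷ []
  r = s₃ ↾ is
  m₁ m₂ zeros : Vec Bool 4
  m₁    = false ∷ true  ∷ true  ∷ false ∷ []
  m₂    = true  ∷ false ∷ false ∷ true  ∷ []
  zeros = false ∷ false ∷ false ∷ false ∷ []
  unique : Unique is
  unique = ( Pattern-distinct P₀₀ P₀₁ (λ { (_ , ()) }) ∷ Pattern-distinct P₀₀ P₁₀ (λ { (() , _) })
           ∷ Pattern-distinct P₀₀ P₁₁ (λ { (() , _) }) ∷ [])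
         ∷ ( Pattern-distinct P₀₁ P₁₀ (λ { (() , _) }) ∷ Pattern-distinct P₀₁ P₁₁ (λ { (() , _) }) ∷ [])
         ∷ ( Pattern-distinct P₁₀ P₁₁ (λ { (_ , ()) }) ∷ [])
         ∷ [] ∷ []
  vec₄ : {a b c e a′ b′ c′ e′ : Bool} → a ≡ a′ → b ≡ b′ → c ≡ c′ → e ≡ e′ →
         a ∷ b ∷ c ∷ e ∷ [] ≡ a′ ∷ b′ ∷ c′ ∷ e′ ∷ []
  vec₄ refl refl refl refl = refl
  equidistant : ∀ s m → dist m₁ m ≡ dist m₂ m → s ↾ is ≡ m ⊕ r →
                dist (m₁ ⊕ r) (s ↾ is) ≡ dist (m₂ ⊕ r) (s ↾ is)
  equidistant s m eq s↾is = begin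
    dist (m₁ ⊕ r) (s ↾ is)  ≡⟨ cong (dist (m₁ ⊕ r)) s↾is ⟩
    dist (m₁ ⊕ r) (m ⊕ r)   ≡⟨ dist-⊕ m₁ m r ⟩
    dist m₁ m               ≡⟨ eq ⟩
    dist m₂ m               ≡⟨ sym (dist-⊕ m₂ m r) ⟩
    dist (m₂ ⊕ r) (m ⊕ r)   ≡⟨ cong (dist (m₂ ⊕ r)) (sym s↾is) ⟩
    dist (m₂ ⊕ r) (s ↾ is)  ∎
    where open ≡-Reasoning

constantColumn? : (S : List (Vertex d)) → Dec (∃ (ConstantColumn S))
constantColumn? S = any? λ i →
  Dec.map′ [ (true ,_) , (false ,_) ]′ (λ { (true , h) → inj₁ h ; (false , h) → inj₂ h })
           (all? (λ s → lookup s i ≟ᵇ true) S ⊎-dec all? (λ s → lookup s i ≟ᵇ false) S)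

-- Each coordinate can be constant for at most one of the four ways of complementing s₁, s₂.
complementation-without-constant-column : {s₁ s₂ s₃ : Vertex d} {rest : List (Vertex d)} →
  MetricGenerator (s₁ ∷ s₂ ∷ s₃ ∷ rest) →
  Σ Bool λ b₁ → Σ Bool λ b₂ →
    ∀ i → ¬ ConstantColumn (complementIf b₁ s₁ ∷ complementIf b₂ s₂ ∷ s₃ ∷ rest) i
complementation-without-constant-column {s₁ = s₁} {s₂} {s₃} {rest} gen
  with constantColumn? (complementIf false s₁ ∷ complementIf false s₂ ∷ s₃ ∷ rest)
     | constantColumn? (complementIf false s₁ ∷ complementIf true  s₂ ∷ s₃ ∷ rest)
     | constantColumn? (complementIf true  s₁ ∷ complementIf false s₂ ∷ s₃ ∷ rest)
     | constantColumn? (complementIf true  s₁ ∷ complementIf true  s₂ ∷ s₃ ∷ rest)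
... | no none | _      | _      | _       = false , false , λ i c → none (i , c)
... | yes _   | no none | _     | _       = false , true  , λ i c → none (i , c)
... | yes _   | yes _  | no none | _      = true  , false , λ i c → none (i , c)
... | yes _   | yes _  | yes _  | no none = true  , true  , λ i c → none (i , c)
... | yes (_ , c₀₀) | yes (_ , c₀₁) | yes (_ , c₁₀) | yes (_ , c₁₁) =
  ⊥-elim (four-patterns⇒¬MetricGenerator
    (ConstantColumn⇒Pattern false false c₀₀) (ConstantColumn⇒Pattern false true c₀₁)
    (ConstantColumn⇒Pattern true  false c₁₀) (ConstantColumn⇒Pattern true  true c₁₁) gen)

mixedMetricGenerator-of-same-length : (S : List (Vertex (3 + d))) → MetricGenerator S →
  Σ (List (Vertex (3 + d))) λ M → MixedMetricGenerator M × length M ≡ length S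
mixedMetricGenerator-of-same-length (s₁ ∷ s₂ ∷ s₃ ∷ rest) gen
  with complementation-without-constant-column gen
... | b₁ , b₂ , nc = _ , mixedMetricGenerator (complementIf-MetricGenerator b₁ b₂ gen) nc , refl
mixedMetricGenerator-of-same-length [] gen =
  ⊥-elim (pair-¬MetricGenerator z z (λ x y x≢y → there (there (gen x y x≢y))))
  where z = replicate _ false
mixedMetricGenerator-of-same-length (s₁ ∷ []) gen =
  ⊥-elim (pair-¬MetricGenerator s₁ s₁ (λ x y x≢y → there (gen x y x≢y)))
mixedMetricGenerator-of-same-length (s₁ ∷ s₂ ∷ []) gen = ⊥-elim (pair-¬MetricGenerator s₁ s₂ gen)

lookup-ext : {u v : Vertex d} → (∀ i → lookup u i ≡ lookup v i) → u ≡ v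
lookup-ext {u = u} {v} h = trans (sym (tabulate∘lookup u)) (trans (tabulate-cong h) (tabulate∘lookup v))

complement-involutive : (u : Vertex d) → complement (complement u) ≡ u
complement-involutive []      = refl
complement-involutive (a ∷ u) = cong₂ _∷_ (not-involutive a) (complement-involutive u)

dist-complementˡ : (u s : Vertex d) → dist (complement u) s + dist u s ≡ d
dist-complementˡ u s = trans (cong₂ _+_ (dist-sym (complement u) s) (dist-sym u s)) (dist-complement s u)

dist-complement-self : (u : Vertex d) → dist (complement u) u ≡ d
dist-complement-self u =
  trans (sym (+-identityʳ _))
        (trans (cong (dist (complement u) u +_) (sym (dist-self u))) (dist-complementˡ u u))

edge-unresolved⇒antipodal : {S : List (Vertex d)} → EdgeMetricGenerator S →
  {x y : Vertex d} → x ≢ y → Unresolved S (dist x) (dist y) → y ≡ complement x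
edge-unresolved⇒antipodal {S = S} egen {x} {y} x≢y unresolved =
  lookup-ext λ i → trans (¬-not (differ i)) (sym (lookup-map i not x))
  where
  differ : ∀ i → lookup y i ≢ lookup x i
  differ i yᵢ≡xᵢ =
    Any¬⇒¬All (egen (edgeAt x i) (edgeAt y i) distinct) (All.map (λ {s} → along s) unresolved)
    where
    distinct : ¬ SameEdge (edgeAt x i) (edgeAt y i)
    distinct (inj₁ (x≡y , _))      = x≢y x≡y
    distinct (inj₂ (x≡flipAt , _)) =
      not-¬ (sym yᵢ≡xᵢ) (trans (cong (λ v → lookup v i) x≡flipAt) (lookup∘update i y _))
    along : ∀ s → dist x s ≡ dist y s → edist (edgeAt x i) s ≡ edist (edgeAt y i) s
    along s eq = trans (edist-flipAt x s i) (trans off-i (sym (edist-flipAt y s i)))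
      where
      off-i : dist (x [ i ]≔ lookup s i) s ≡ dist (y [ i ]≔ lookup s i) s
      off-i = +-cancelʳ-≡ (bitDist (lookup x i) (lookup s i)) _ _
        (trans (sym (dist-split x s i))
        (trans eq (trans (dist-split y s i) (cong (λ b → _ + bitDist b (lookup s i)) yᵢ≡xᵢ))))

dist-∧-∨ : (a p s : Vertex d) → dist (zipWith _∧_ a p) s + dist (zipWith _∨_ a p) s ≡ dist a s + dist p s
dist-∧-∨ []      []      []      = refl
dist-∧-∨ (x ∷ a) (y ∷ p) (z ∷ s) = begin
  dist ((x ∧ y) ∷ zipWith _∧_ a p) (z ∷ s) + dist ((x ∨ y) ∷ zipWith _∨_ a p) (z ∷ s)
    ≡⟨ cong₂ _+_ (dist-∷ (x ∧ y) z _ s) (dist-∷ (x ∨ y) z _ s) ⟩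
  (bitDist (x ∧ y) z + dist (zipWith _∧_ a p) s) + (bitDist (x ∨ y) z + dist (zipWith _∨_ a p) s)
    ≡⟨ Nat.interchange (bitDist (x ∧ y) z) _ (bitDist (x ∨ y) z) _ ⟩
  (bitDist (x ∧ y) z + bitDist (x ∨ y) z) + (dist (zipWith _∧_ a p) s + dist (zipWith _∨_ a p) s)
    ≡⟨ cong₂ _+_ (bits x y z) (dist-∧-∨ a p s) ⟩
  (bitDist x z + bitDist y z) + (dist a s + dist p s)
    ≡⟨ Nat.interchange (bitDist x z) (bitDist y z) (dist a s) (dist p s) ⟩
  (bitDist x z + dist a s) + (bitDist y z + dist p s)
    ≡⟨ sym (cong₂ _+_ (dist-∷ x z a s) (dist-∷ y z p s)) ⟩
  dist (x ∷ a) (z ∷ s) + dist (y ∷ p) (z ∷ s) ∎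
  where
  open ≡-Reasoning
  bits : ∀ x y z → bitDist (x ∧ y) z + bitDist (x ∨ y) z ≡ bitDist x z + bitDist y z
  bits true  y z = +-comm (bitDist y z) (bitDist true z)
  bits false y z = refl

∧≡¬∨⇒≡complement : (a p : Vertex d) → zipWith _∧_ a p ≡ complement (zipWith _∨_ a p) → p ≡ complement a
∧≡¬∨⇒≡complement []      []      _  = refl
∧≡¬∨⇒≡complement (x ∷ a) (y ∷ p) eq =
  cong₂ _∷_ (bit x y (∷-injectiveˡ eq)) (∧≡¬∨⇒≡complement a p (∷-injectiveʳ eq))
  where
  bit : ∀ x y → x ∧ y ≡ not (x ∨ y) → y ≡ not x
  bit true  false _ = refl
  bit false true  _ = refl

¬∨≡¬∧⇒≡ : (a p : Vertex d) → complement (zipWith _∨_ a p) ≡ complement (zipWith _∧_ a p) → p ≡ a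
¬∨≡¬∧⇒≡ []      []      _  = refl
¬∨≡¬∧⇒≡ (x ∷ a) (y ∷ p) eq = cong₂ _∷_ (bit x y (∷-injectiveˡ eq)) (¬∨≡¬∧⇒≡ a p (∷-injectiveʳ eq))
  where
  bit : ∀ x y → not (x ∨ y) ≡ not (x ∧ y) → y ≡ x
  bit true  true  _ = refl
  bit false false _ = refl

double-injective : ∀ m n → m + m ≡ n + n → m ≡ n
double-injective zero    zero    _  = refl
double-injective (suc m) (suc n) eq = cong suc (double-injective m n
  (suc-injective (trans (sym (+-suc m m)) (trans (suc-injective eq) (+-suc n n)))))

∧-¬∨-unresolved : {S : List (Vertex d)} {a p : Vertex d} →
  Unresolved S (dist a) (dist (complement a)) → Unresolved S (dist p) (dist (complement p)) →
  Unresolved S (dist (zipWith _∧_ a p)) (dist (complement (zipWith _∨_ a p)))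
∧-¬∨-unresolved {d} {a = a} {p} [] [] = []
∧-¬∨-unresolved {d} {a = a} {p} (_∷_ {s} hₐ hsₐ) (hₚ ∷ hsₚ) =
  +-cancelʳ-≡ (dist (zipWith _∨_ a p) s) _ _ (begin
    dist (zipWith _∧_ a p) s + dist (zipWith _∨_ a p) s  ≡⟨ dist-∧-∨ a p s ⟩
    dist a s + dist p s                                  ≡⟨ cong (dist a s +_) (sym a≡p) ⟩
    dist a s + dist a s                                  ≡⟨ halfway a hₐ ⟩
    d                                                    ≡⟨ sym (dist-complementˡ (zipWith _∨_ a p) s) ⟩
    dist (complement (zipWith _∨_ a p)) s + dist (zipWith _∨_ a p) s ∎)
  ∷ ∧-¬∨-unresolved {a = a} {p} hsₐ hsₚ
  where
  open ≡-Reasoning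
  halfway : ∀ v → dist v s ≡ dist (complement v) s → dist v s + dist v s ≡ d
  halfway v eq = trans (cong (dist v s +_) eq) (trans (+-comm (dist v s) _) (dist-complementˡ v s))
  a≡p : dist a s ≡ dist p s
  a≡p = double-injective (dist a s) (dist p s) (trans (halfway a hₐ) (sym (halfway p hₚ)))

two-antipodal-pairs : {S : List (Vertex d)} → EdgeMetricGenerator S → {a p : Vertex d} →
  Unresolved S (dist a) (dist (complement a)) → Unresolved S (dist p) (dist (complement p)) →
  p ≡ a ⊎ p ≡ complement a
two-antipodal-pairs egen {a} {p} unresolvedᵃ unresolvedᵖ
  with zipWith _∧_ a p ≟ᵛ complement (zipWith _∨_ a p)
... | yes ∧≡¬∨ = inj₂ (∧≡¬∨⇒≡complement a p ∧≡¬∨)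
... | no  ∧≢¬∨ = inj₁ (¬∨≡¬∧⇒≡ a p
  (edge-unresolved⇒antipodal egen ∧≢¬∨ (∧-¬∨-unresolved {a = a} {p} unresolvedᵃ unresolvedᵖ)))

vertices : ∀ d → List (Vertex d)
vertices zero    = [] ∷ []
vertices (suc d) = List.map (true ∷_) (vertices d) ++ List.map (false ∷_) (vertices d)

∈-vertices : (v : Vertex d) → v ∈ vertices d
∈-vertices []          = here refl
∈-vertices (true ∷ v)  = ∈-++⁺ˡ (∈-map⁺ (true ∷_) (∈-vertices v))
∈-vertices (false ∷ v) = ∈-++⁺ʳ _ (∈-map⁺ (false ∷_) (∈-vertices v))

∃-vertex? : {P : Vertex d → Set} → Decidable P → Dec (∃ P)
∃-vertex? P? = Dec.map′ satisfied (λ (v , p) → lose (∈-vertices v) p) (Any.any? P? (vertices _))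

∀-vertex? : {P : Vertex d → Set} → Decidable P → Dec (∀ v → P v)
∀-vertex? P? = Dec.map′ (λ all v → All.lookup all (∈-vertices v)) (λ all → All.tabulate λ {v} _ → all v)
                        (all? P? (vertices _))

vertices-MetricGenerator : MetricGenerator (vertices d)
vertices-MetricGenerator a b a≢b =
  lose (∈-vertices a) λ eq → a≢b (sym (dist≡0⇒≡ b a (trans (sym eq) (dist-self a))))

metricGenerator? : Decidable (MetricGenerator {d})
metricGenerator? S = ∀-vertex? λ a → ∀-vertex? λ b →
  ¬? (a ≟ᵛ b) →-dec Any.any? (λ s → ¬? (dist a s ≟ dist b s)) S

edgeMetricGenerator? : Decidable (EdgeMetricGenerator {d})
edgeMetricGenerator? S = Dec.map′
  (λ h → λ { (edge u₁ v₁ p₁) (edge u₂ v₂ p₂) → h u₁ v₁ u₂ v₂ p₁ p₂ })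
  (λ h u₁ v₁ u₂ v₂ p₁ p₂ → h (edge u₁ v₁ p₁) (edge u₂ v₂ p₂))
  (∀-vertex? λ u₁ → ∀-vertex? λ v₁ → ∀-vertex? λ u₂ → ∀-vertex? λ v₂ →
    (dist u₁ v₁ ≟ 1) →-dec (dist u₂ v₂ ≟ 1) →-dec
    ¬? ((u₁ ≟ᵛ u₂ ×-dec v₁ ≟ᵛ v₂) ⊎-dec (u₁ ≟ᵛ v₂ ×-dec v₁ ≟ᵛ u₂)) →-dec
    Any.any? (λ s → ¬? (dist u₁ s ⊓ dist v₁ s ≟ dist u₂ s ⊓ dist v₂ s)) S)

∃-list? : ∀ n {P : List (Vertex d) → Set} → Decidable P →
          Dec (Σ (List (Vertex d)) λ S → P S × length S ≡ n)
∃-list? zero    P? = Dec.map′ (λ p → [] , p , refl) (λ { ([] , p , _) → p }) (P? [])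
∃-list? (suc n) P? = Dec.map′ (λ (v , S , p , eq) → v ∷ S , p , cong suc eq)
                              (λ { (v ∷ S , p , eq) → v , S , p , suc-injective eq })
                              (∃-vertex? λ v → ∃-list? n (P? ∘ (v ∷_)))

Least : (ℕ → Set) → Set
Least Q = Σ ℕ λ k → Q k × (∀ m → Q m → k ≤ m)

least : {Q : ℕ → Set} → Decidable Q → ∀ n → Q n → Least Q
least {Q = Q} Q? = <-rec (λ n → Q n → Least Q) step
  where
  step : ∀ n → (∀ {m} → m < n → Q m → Least Q) → Q n → Least Q
  step n smaller qₙ with anyUpTo? Q? n
  ... | yes (m , m<n , qₘ) = smaller m<n qₘ
  ... | no  none           = n , qₙ , λ m qₘ → ≮⇒≥ λ m<n → none (m , m<n , qₘ)

minimum : {P : List (Vertex d) → Set} → Decidable P → {S : List (Vertex d)} → P S → Σ ℕ (IsMinCard P)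
minimum P? {S} pₛ with least (λ n → ∃-list? n P?) (length S) (S , pₛ , refl)
... | k , witness , below = k , witness , λ S′ p′ → below (length S′) (S′ , p′ , refl)

antipode-resolved : {x a : Vertex (suc d)} → x ≡ a ⊎ x ≡ complement a → dist x a ≢ dist (complement x) a
antipode-resolved {a = a} (inj₁ refl) eq =
  0≢1+n (trans (sym (dist-self a)) (trans eq (dist-complement-self a)))
antipode-resolved {a = a} (inj₂ refl) eq =
  0≢1+n (trans (sym (trans (cong (λ v → dist v a) (complement-involutive a)) (dist-self a)))
               (trans (sym eq) (dist-complement-self a)))

extend-EdgeMetricGenerator : (S : List (Vertex (suc d))) → EdgeMetricGenerator S →
  Σ (List (Vertex (suc d))) λ S′ → MetricGenerator S′ × length S′ ≡ suc (length S)
extend-EdgeMetricGenerator S egen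
  with ∃-vertex? (λ a → ∃-vertex? λ b → ¬? (a ≟ᵛ b) ×-dec all? (λ s → dist a s ≟ dist b s) S)
... | no none =
  replicate _ false ∷ S , (λ x y x≢y → there (separated S λ un → none (x , y , x≢y , un))) , refl
... | yes (a , b , a≢b , unresolvedᵃᵇ) = a ∷ S , gen , refl
  where
  unresolvedᵃ : Unresolved S (dist a) (dist (complement a))
  unresolvedᵃ = subst (λ b → Unresolved S (dist a) (dist b))
                      (edge-unresolved⇒antipodal egen a≢b unresolvedᵃᵇ) unresolvedᵃᵇ
  gen : MetricGenerator (a ∷ S)
  gen x y x≢y with all? (λ s → dist x s ≟ dist y s) S
  ... | no  resolved   = there (separated S resolved)
  ... | yes unresolved = here λ eq →
    antipode-resolved {x = x} {a} (two-antipodal-pairs egen {a} {x} unresolvedᵃ unresolvedˣ)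
                      (trans eq (cong (λ v → dist v a) y≡x̄))
    where
    y≡x̄ = edge-unresolved⇒antipodal egen x≢y unresolved
    unresolvedˣ : Unresolved S (dist x) (dist (complement x))
    unresolvedˣ = subst (λ y → Unresolved S (dist x) (dist y)) y≡x̄ unresolved

corollary8 : (d : ℕ) → 3 ≤ d →
    Σ ℕ λ dm → Σ ℕ λ em → Σ ℕ λ mm →
    IsDim d dm × IsEdim d em × IsMdim d mm ×
    dm ≤ em + 1 × em ≤ dm × dm ≡ mm
corollary8 1 (s≤s ())
corollary8 2 (s≤s (s≤s ()))
corollary8 d@(suc (suc (suc _))) _
  with minimum metricGenerator? (vertices-MetricGenerator {d})
... | dm , isDim@((S , gen , |S|≡dm) , dm-least)
  with mixedMetricGenerator-of-same-length S gen
... | M , mixed , |M|≡|S|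
  with minimum edgeMetricGenerator? (λ e f → mixed (inj₂ e) (inj₂ f))
... | em , isEdim@((E , egen , |E|≡em) , em-least)
  with extend-EdgeMetricGenerator E egen
... | S′ , gen′ , |S′|≡1+|E| =
  dm , em , dm , isDim , isEdim ,
  ((M , mixed , trans |M|≡|S| |S|≡dm) , λ T mixedᵀ → dm-least T λ x y → mixedᵀ (inj₁ x) (inj₁ y)) ,
  ≤-trans (dm-least S′ gen′) (≤-reflexive (trans |S′|≡1+|E| (trans (cong suc |E|≡em) (+-comm 1 em)))) ,
  ≤-trans (em-least M λ e f → mixed (inj₂ e) (inj₂ f)) (≤-reflexive (trans |M|≡|S| |S|≡dm)) ,
  refl
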